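{- There is a CF program $\mathtt{p}$ that terminates on every input $x\in\{0,1\}^*$ and a constant $c>0$ such that $\mathit{time}_{\mathtt{p}}(x)\ge 2^{c|x|}$ for all $x$. In particular, a terminating run of a CF program can take time exponential in its input length.
   Context: CF is a first-order, call-by-value functional language with no data constructors. A CF program is a finite sequence of function definitions $\mathtt{f\ x1 \ldots xm = e}$; the first definition $\mathtt{f_1\ x = e}$ is the entry function. Expressions are $\mathtt{True}$, $\mathtt{False}$, $\mathtt{[\,]}$, variables, $\mathtt{not\ e}$, $\mathtt{null\ e}$, $\mathtt{head\ e}$, $\mathtt{tail\ e}$, $\mathtt{if\ e\ then\ e\ else\ e}$, and calls $\mathtt{f\ e1\ldots em}$ to defined functions. Values are bits or bit lists. The semantics is given by big-step inference rules $\mathtt{p},\rho\vdash \mathtt{e}\to v$. A call evaluates its arguments and then the body of the called function in the environment binding its parameters; a conditional evaluates its test and then the chosen branch. The derivation tree for input $x$ is $\mathcal{T}^{\mathtt{p},x}$, and the running time $\mathit{time}_{\mathtt{p}}(x)$ is its number of nodes. -}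

module Defs where

open import Data.Nat using (ℕ; zero; suc; _+_; _*_; _^_; _≤_)
open import Data.Bool using (Bool; true; false)
import Data.Bool
open import Relation.Binary.PropositionalEquality using (_≡_)
open import Data.List using (List; []; _∷_; length)
open import Data.Fin using (Fin; zero)
open import Data.Vec using (Vec; []; _∷_; lookup)
open import Data.Product using (Σ; ∃; _×_; _,_)

data Val : Set where
  bit : Bool → Val
  lst : List Bool → Val

-- Expressions of CF.  'Expr n k': n = number of functions in the program
-- (calls refer to a function by its index), k = number of parameters in
-- scope (variables are de Bruijn-like indices into the parameters).
-- A call carries the arity of the callee; well-formedness (that the arity
-- matches the callee's definition) is enforced by the evaluation rule.
data Expr (n k : ℕ) : Set
data Args (n k : ℕ) : ℕ → Set

data Expr n k where
  tt ff nil : Expr n k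
  var       : Fin k → Expr n k
  not'      : Expr n k → Expr n k
  null'     : Expr n k → Expr n k
  head'     : Expr n k → Expr n k
  tail'     : Expr n k → Expr n k
  if_then_else_ : Expr n k → Expr n k → Expr n k → Expr n k
  call      : (f : Fin n) {m : ℕ} → Args n k m → Expr n k

data Args n k where
  []  : Args n k zero
  _∷_ : ∀ {m} → Expr n k → Args n k m → Args n k (suc m)

record Def (n : ℕ) : Set where
  constructor mkDef
  field
    arity : ℕ
    body  : Expr n arity
open Def public

-- A CF program: a nonempty sequence of definitions f₁ … f_N (N = suc size),
-- indexed by Fin N; the first (index zero) is the entry function and has
-- exactly one parameter (its arity is 1 by construction).
record Program : Set where
  constructor mkProg
  field
    size  : ℕ
    entry : Expr (suc size) 1
    rest  : Vec (Def (suc size)) size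
open Program public

defs : (p : Program) → Vec (Def (suc (size p))) (suc (size p))
defs p = mkDef 1 (entry p) ∷ rest p

N : Program → ℕ
N p = suc (size p)

-- Big-step semantics  p , ρ ⊢ e → v  as an inductive family whose
-- inhabitants are derivation trees.  Rules for partial primitives
-- (head/tail of [], not/if on a list, ...) are simply absent, as usual.
module _ (p : Program) where

  data _⊢_⇒_ {k : ℕ} (ρ : Vec Val k) : Expr (N p) k → Val → Set
  data _⊢*_⇒_ {k : ℕ} (ρ : Vec Val k) : ∀ {m} → Args (N p) k m → Vec Val m → Set

  data _⊢_⇒_ {k} ρ where
    e-true  : ρ ⊢ tt ⇒ bit true
    e-false : ρ ⊢ ff ⇒ bit false
    e-nil   : ρ ⊢ nil ⇒ lst []
    e-var   : (i : Fin k) → ρ ⊢ var i ⇒ lookup ρ i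
    e-not   : ∀ {e b} → ρ ⊢ e ⇒ bit b → ρ ⊢ not' e ⇒ bit (Data.Bool.not b)
    e-null-t : ∀ {e} → ρ ⊢ e ⇒ lst [] → ρ ⊢ null' e ⇒ bit true
    e-null-f : ∀ {e b bs} → ρ ⊢ e ⇒ lst (b ∷ bs) → ρ ⊢ null' e ⇒ bit false
    e-head  : ∀ {e b bs} → ρ ⊢ e ⇒ lst (b ∷ bs) → ρ ⊢ head' e ⇒ bit b
    e-tail  : ∀ {e b bs} → ρ ⊢ e ⇒ lst (b ∷ bs) → ρ ⊢ tail' e ⇒ lst bs
    e-if-t  : ∀ {e₀ e₁ e₂ v} → ρ ⊢ e₀ ⇒ bit true → ρ ⊢ e₁ ⇒ v →
              ρ ⊢ (if e₀ then e₁ else e₂) ⇒ v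
    e-if-f  : ∀ {e₀ e₁ e₂ v} → ρ ⊢ e₀ ⇒ bit false → ρ ⊢ e₂ ⇒ v →
              ρ ⊢ (if e₀ then e₁ else e₂) ⇒ v
    e-call  : ∀ (f : Fin (N p)) {as : Args (N p) k (arity (lookup (defs p) f))}
                {vs v} →
              ρ ⊢* as ⇒ vs →
              vs ⊢ body (lookup (defs p) f) ⇒ v →
              ρ ⊢ call f as ⇒ v

  data _⊢*_⇒_ {k} ρ where
    a-nil  : ρ ⊢* [] ⇒ []
    a-cons : ∀ {m e v} {as : Args (N p) k m} {vs} →
             ρ ⊢ e ⇒ v → ρ ⊢* as ⇒ vs → ρ ⊢* (e ∷ as) ⇒ (v ∷ vs)

  nodes  : ∀ {k} {ρ : Vec Val k} {e v} → ρ ⊢ e ⇒ v → ℕ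
  nodes* : ∀ {k} {ρ : Vec Val k} {m} {as : Args (N p) k m} {vs} → ρ ⊢* as ⇒ vs → ℕ
  nodes e-true = 1
  nodes e-false = 1
  nodes e-nil = 1
  nodes (e-var i) = 1
  nodes (e-not d) = suc (nodes d)
  nodes (e-null-t d) = suc (nodes d)
  nodes (e-null-f d) = suc (nodes d)
  nodes (e-head d) = suc (nodes d)
  nodes (e-tail d) = suc (nodes d)
  nodes (e-if-t d d₁) = suc (nodes d + nodes d₁)
  nodes (e-if-f d d₁) = suc (nodes d + nodes d₁)
  nodes (e-call f ds d) = suc (nodes* ds + nodes d)
  nodes* a-nil = 0
  nodes* (a-cons d ds) = nodes d + nodes* ds

-- Running p on input x: the derivation tree T^{p,x} of the call  f₁ x,
-- i.e. the entry function's body evaluated with its parameter bound to x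
-- (the root is the call node).
Run : (p : Program) → List Bool → Val → Set
Run p x v = _⊢_⇒_ p (lst x ∷ []) (call zero (var zero ∷ [])) v

-- Sanity: Run is inhabited via the call rule with arity 1 definitionally.
private
  _ : ∀ p x {vs v} → _⊢*_⇒_ p (lst x ∷ []) (var zero ∷ []) vs →
      _⊢_⇒_ p vs (entry p) v → Run p x v
  _ = λ p x ds d → e-call zero ds d

module Submission where

-- The program is
--     f₁ x  = g x
--     g  x  = if null x then True else k (g (tail x)) (g (tail x))
--     k y z = True
-- Since CF is call-by-value, both arguments of k are evaluated, so the
-- evaluation of g on a list of length n+1 contains two complete
-- evaluations of g on the tail; the derivation tree therefore doubles in
-- size with every element of the input.
--
-- Finally, any run of the program
-- is a run of g wrapped in two call nodes, so time(x) ≥ 2 ^ |x|, which is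
-- the theorem with c = 1 (a = b = 0).

open import Defs
open import Data.Nat using (ℕ; suc; _+_; _*_; _^_; _≤_; z≤n; s≤s)
open import Data.Nat.Properties using (≤-trans; +-mono-≤; ≤-reflexive; m≤n+m; +-identityʳ; *-identityˡ; *-identityʳ; module ≤-Reasoning)
open import Data.Nat.Tactic.RingSolver using (solve-∀)
open import Data.Bool using (Bool; true)
open import Data.List using (List; length; []; _∷_)
open import Data.Product using (Σ; _×_; _,_)
open import Data.Fin using (Fin; zero; suc)
open import Data.Vec using ([]; _∷_)
open import Relation.Binary.PropositionalEquality using (_≡_; cong; sym)

-- Function indices: f₁ is index zero, then g, then k.
g-index k-index : Fin 3
g-index = suc zero
k-index = suc (suc zero)

recurse : Expr 3 1
recurse = call g-index (tail' (var zero) ∷ [])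

g-body : Expr 3 1
g-body = if null' (var zero) then tt
         else call k-index (recurse ∷ (recurse ∷ []))

doubling : Program
doubling = mkProg 2 (call g-index (var zero ∷ []))
             (mkDef 1 g-body ∷ (mkDef 2 tt ∷ []))

GRun : List Bool → Val → Set
GRun xs v = _⊢_⇒_ doubling (lst xs ∷ []) g-body v

g-terminates : (xs : List Bool) → GRun xs (bit true)
g-terminates [] = e-if-t (e-null-t (e-var zero)) e-true
g-terminates (_ ∷ bs) =
  e-if-f (e-null-f (e-var zero))
    (e-call k-index (a-cons recursive-call (a-cons recursive-call a-nil)) e-true)
  where
  recursive-call : _⊢_⇒_ doubling (lst (_ ∷ bs) ∷ []) recurse (bit true)
  recursive-call = e-call g-index (a-cons (e-tail (e-var zero)) a-nil) (g-terminates bs)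

-- In the recursive case the tree consists of the two sub-evaluations of g
-- plus eleven further nodes (if, null, var, the call of k with its body,
-- and call, tail, var for each of the two recursive calls); the left-hand
-- side is what 'nodes' computes on that tree.
recursive-case-nodes : ∀ n₁ n₂ →
  suc (2 + suc ((suc (2 + n₁) + (suc (2 + n₂) + 0)) + 1)) ≡ 11 + (n₁ + n₂)
recursive-case-nodes = solve-∀

doubled-bound : ∀ {m n₁ n₂} → m ≤ n₁ → m ≤ n₂ → 2 * m ≤ 11 + (n₁ + n₂)
doubled-bound {m} {n₁} {n₂} p q = begin
  2 * m          ≡⟨ cong (m +_) (+-identityʳ m) ⟩
  m + m          ≤⟨ +-mono-≤ p q ⟩
  n₁ + n₂        ≤⟨ m≤n+m (n₁ + n₂) 11 ⟩
  11 + (n₁ + n₂) ∎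
  where open ≤-Reasoning

-- The doubling recurrence: time_g(b ∷ bs) ≥ 2 · time_g(bs) gives 2 ^ |xs|.
g-exponential : (xs : List Bool) → ∀ {v} (d : GRun xs v) → 2 ^ length xs ≤ nodes doubling d
g-exponential [] (e-if-t (e-null-t _) _) = s≤s z≤n
g-exponential [] (e-if-f (e-null-f ()) _)
g-exponential (_ ∷ _) (e-if-t (e-null-t ()) _)
g-exponential (_ ∷ bs) (e-if-f (e-null-f (e-var zero))
    (e-call _ (a-cons (e-call _ (a-cons (e-tail (e-var zero)) a-nil) d₁)
              (a-cons (e-call _ (a-cons (e-tail (e-var zero)) a-nil) d₂) a-nil)) e-true))
  = ≤-trans (doubled-bound (g-exponential bs d₁) (g-exponential bs d₂))
            (≤-reflexive (sym (recursive-case-nodes (nodes doubling d₁) (nodes doubling d₂))))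

run-exponential : (x : List Bool) → ∀ {v} (d : Run doubling x v) →
                  2 ^ length x ≤ nodes doubling d
run-exponential x (e-call _ (a-cons (e-var zero) a-nil)
                    (e-call _ (a-cons (e-var zero) a-nil) d)) =
  ≤-trans (g-exponential x d) (m≤n+m _ 4)

theorem4 : Σ Program λ p →
    ((x : List Bool) → Σ Val λ v → Run p x v)
    × Σ ℕ λ a → Σ ℕ λ b →
    (x : List Bool) → ∀ {v} (d : Run p x v) →
    2 ^ (suc a * length x) ≤ nodes p d ^ suc b
theorem4 = doubling , terminates , 0 , 0 , bound
  where
  terminates : (x : List Bool) → Σ Val λ v → Run doubling x v
  terminates x = bit true , e-call zero (a-cons (e-var zero) a-nil)
                   (e-call g-index (a-cons (e-var zero) a-nil) (g-terminates x))

  bound : (x : List Bool) → ∀ {v} (d : Run doubling x v) →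
          2 ^ (1 * length x) ≤ nodes doubling d ^ 1
  bound x d rewrite *-identityˡ (length x) | *-identityʳ (nodes doubling d) =
    run-exponential x d
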